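{- If $G$ is a finite simple bipartite graph, then $b_2(G) = \frac{r_2(G)}{2}$. Furthermore, for a bipartition $V(G)=A\cup B$, there exists a minimum odd cover of $G$ that respects this bipartition, i.e., every biclique $(X,Y)$ in it has $X\subseteq A$ and $Y\subseteq B$ (or vice versa).
   Context: For a finite simple graph $G=(V,E)$, a biclique on a subset of $V$ is given by two disjoint sets $X,Y\subseteq V$ (written $(X,Y)$); its edges are all pairs $\{x,y\}$ with $x\in X$, $y\in Y$. An odd cover of $G$ is a collection of bicliques on subsets of $V$ such that every pair of vertices adjacent in $G$ is an edge of an odd number of the bicliques, and every pair of distinct non-adjacent vertices is an edge of an even number of the bicliques. $b_2(G)$ denotes the minimum cardinality of an odd cover of $G$. $r_2(G)$ denotes the rank over $\mathbb{F}_2$ of the adjacency matrix of $G$. -}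

module Defs where

open import Data.Nat using (ℕ; zero; suc; _≤_)
open import Data.Bool using (Bool; true; false; _xor_; _∧_; _∨_; if_then_else_)
open import Data.Fin using (Fin)
open import Data.List using (List; []; _∷_; length)
open import Data.Product using (Σ; _×_; ∃)
open import Data.Sum using (_⊎_)
open import Data.List.Relation.Unary.All using (All)
open import Relation.Binary.PropositionalEquality using (_≡_; _≢_)

record Graph (n : ℕ) : Set where
  field
    adj     : Fin n → Fin n → Bool
    symm    : ∀ u v → adj u v ≡ adj v u
    irrefl  : ∀ u → adj u u ≡ false
open Graph public

VSet : ℕ → Set
VSet n = Fin n → Bool

_⊆_ : ∀ {n} → VSet n → VSet n → Set
X ⊆ Y = ∀ v → X v ≡ true → Y v ≡ true

Disjoint : ∀ {n} → VSet n → VSet n → Set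
Disjoint X Y = ∀ v → X v ∧ Y v ≡ false

record Biclique (n : ℕ) : Set where
  constructor biclique
  field
    X        : VSet n
    Y        : VSet n
    disjoint : Disjoint X Y
open Biclique public

hasEdge : ∀ {n} → Biclique n → Fin n → Fin n → Bool
hasEdge B u v = (X B u ∧ Y B v) ∨ (X B v ∧ Y B u)

edgeParity : ∀ {n} → List (Biclique n) → Fin n → Fin n → Bool
edgeParity []       u v = false
edgeParity (B ∷ Bs) u v = hasEdge B u v xor edgeParity Bs u v

OddCover : ∀ {n} → Graph n → List (Biclique n) → Set
OddCover G Bs = ∀ u v → u ≢ v → edgeParity Bs u v ≡ adj G u v

-- A minimum odd cover (its length is b₂(G)).
MinimumOddCover : ∀ {n} → Graph n → List (Biclique n) → Set
MinimumOddCover G Bs =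
  OddCover G Bs × (∀ Cs → OddCover G Cs → length Bs ≤ length Cs)

Vec₂ : ℕ → Set
Vec₂ n = Fin n → Bool

lincomb : ∀ {n} (k : ℕ) → (Fin k → Bool) → (Fin k → Vec₂ n) → Vec₂ n
lincomb zero    c v j = false
lincomb (suc k) c v j =
  (c Fin.zero ∧ v Fin.zero j) xor lincomb k (λ i → c (Fin.suc i)) (λ i → v (Fin.suc i)) j

LinIndep : ∀ {n} (k : ℕ) → (Fin k → Vec₂ n) → Set
LinIndep k v = ∀ c → (∀ j → lincomb k c v j ≡ false) → ∀ i → c i ≡ false

IsRank₂ : ∀ {n} → (Fin n → Fin n → Bool) → ℕ → Set
IsRank₂ {n} M r =
  Σ (Fin r → Fin n) (λ rows → LinIndep r (λ i → M (rows i)))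
  × (∀ k (rows : Fin k → Fin n) → LinIndep k (λ i → M (rows i)) → k ≤ r)

-- side : Fin n → Bool describes a bipartition V = A ∪ B
-- (A = side⁻¹ true, B = side⁻¹ false); it is a bipartition of G if
-- every edge joins A and B.
IsBipartition : ∀ {n} → Graph n → (Fin n → Bool) → Set
IsBipartition G side = ∀ u v → adj G u v ≡ true → side u ≢ side v

SideA SideB : ∀ {n} → (Fin n → Bool) → VSet n
SideA side v = side v
SideB side v = if side v then false else true

RespectsBiclique : ∀ {n} → (Fin n → Bool) → Biclique n → Set
RespectsBiclique side B =
  (X B ⊆ SideA side × Y B ⊆ SideB side) ⊎ (X B ⊆ SideB side × Y B ⊆ SideA side)

Respects : ∀ {n} → (Fin n → Bool) → List (Biclique n) → Set
Respects side Bs = All (RespectsBiclique side) Bs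

-- An odd cover by k bicliques (Xᵢ , Yᵢ) writes the adjacency matrix over F₂ as
-- Σᵢ (1_Xᵢ 1_Yᵢᵀ + 1_Yᵢ 1_Xᵢᵀ) (the diagonal vanishes since Xᵢ ∩ Yᵢ = ∅), so every
-- row lies in the span of the 2k vectors 1_Xᵢ, 1_Yᵢ and r₂(G) ≤ 2k by the exchange lemma.
-- Conversely, if M is symmetric and vanishes inside both sides of the bipartition
-- and M a b = 1, then x = (column b) and y = (row a) form a biclique respecting the
-- bipartition, M + x yᵀ + y xᵀ is again of this kind with rows and columns a, b zero,
-- and rows a, b together with independent rows of the new matrix are independent
-- in M.  Eliminating vertex by vertex produces a respecting odd cover by k bicliques
-- together with 2k independent rows, so 2k ≤ r₂(G).
module Submission where

open import Defs
open import Level using (0ℓ)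
open import Data.Nat using (ℕ; zero; suc; _+_; _*_; _≤_; z≤n; s≤s)
open import Data.Nat.Properties using (≤-antisym; *-suc; *-cancelˡ-≤; m≤n⇒m≤1+n)
open import Data.Bool using (Bool; true; false; not; _xor_; _∧_; if_then_else_)
open import Data.Bool.Properties
  using (_≟_; xor-∧-commutativeRing; xor-comm; xor-assoc; xor-same; xor-identityʳ;
         ∧-comm; ∧-zeroʳ; ∧-identityʳ; ∨-identityʳ; ¬-not; not-injective)
open import Data.Fin using (Fin; zero; suc; punchIn) renaming (_≟_ to _≟ᶠ_)
open import Data.Fin.Properties using (any?)
open import Data.Vec.Functional using (insertAt; tail)
import Data.Vec.Functional as Vector
open import Data.Vec.Functional.Properties using (insertAt-punchIn)
open import Data.List using (List; []; _∷_; length; lookup; allFin)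
open import Data.List.Relation.Unary.All using ([]; _∷_)
open import Data.List.Relation.Unary.Any using (here; there)
open import Data.List.Membership.Propositional using (_∈_)
open import Data.List.Membership.Propositional.Properties using (∈-allFin)
open import Data.Maybe using (Maybe; just; nothing)
open import Data.Product using (Σ; _×_; _,_; proj₁; proj₂)
open import Data.Sum using (inj₁; inj₂)
open import Data.Empty using (⊥-elim)
open import Function using (_∘_)
open import Relation.Nullary using (¬_; yes; no)
open import Relation.Binary.PropositionalEquality
  using (_≡_; _≢_; refl; sym; trans; cong; cong₂; subst; module ≡-Reasoning)
open import Tactic.RingSolver using (solve-∀)
open import Tactic.RingSolver.Core.AlmostCommutativeRing
  using (AlmostCommutativeRing; fromCommutativeRing)

open ≡-Reasoning

𝔽₂ : AlmostCommutativeRing 0ℓ 0ℓ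
𝔽₂ = fromCommutativeRing xor-∧-commutativeRing isZero
  where
  isZero : (b : Bool) → Maybe (false ≡ b)
  isZero false = just refl
  isZero true  = nothing

true≢false : true ≢ false
true≢false ()

xor≡false⇒≡ : ∀ {a b} → a xor b ≡ false → a ≡ b
xor≡false⇒≡ {true}  {true}  _ = refl
xor≡false⇒≡ {false} {false} _ = refl

xor-cancelʳ : ∀ a b → (a xor b) xor b ≡ a
xor-cancelʳ = solve-∀ 𝔽₂

xor-cancelˡ : ∀ a b → b xor (a xor b) ≡ a
xor-cancelˡ = solve-∀ 𝔽₂

xor-exchange : ∀ a b c → a xor (b xor c) ≡ b xor (a xor c)
xor-exchange = solve-∀ 𝔽₂

-- Linear algebra over F₂

dot : ∀ k → (Fin k → Bool) → (Fin k → Bool) → Bool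
dot zero    c d = false
dot (suc k) c d = (c zero ∧ d zero) xor dot k (tail c) (tail d)

InSpan : ∀ {n} m → (Fin m → Vec₂ n) → Vec₂ n → Set
InSpan m w v = Σ (Fin m → Bool) λ c → ∀ j → lincomb m c w j ≡ v j

dot-zeroˡ : ∀ k (c d : Fin k → Bool) → (∀ i → c i ≡ false) → dot k c d ≡ false
dot-zeroˡ zero    c d c≡0 = refl
dot-zeroˡ (suc k) c d c≡0 rewrite c≡0 zero = dot-zeroˡ k (tail c) (tail d) (c≡0 ∘ suc)

lincomb-zeroˡ : ∀ {n} k (c : Fin k → Bool) (v : Fin k → Vec₂ n) j →
                (∀ i → c i ≡ false) → lincomb k c v j ≡ false
lincomb-zeroˡ zero    c v j c≡0 = refl
lincomb-zeroˡ (suc k) c v j c≡0 rewrite c≡0 zero = lincomb-zeroˡ k (tail c) (tail v) j (c≡0 ∘ suc)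

lincomb-zeroʳ : ∀ {n} k (c : Fin k → Bool) (v : Fin k → Vec₂ n) j →
                (∀ i → v i j ≡ false) → lincomb k c v j ≡ false
lincomb-zeroʳ zero    c v j vⱼ≡0 = refl
lincomb-zeroʳ (suc k) c v j vⱼ≡0
  rewrite vⱼ≡0 zero | ∧-zeroʳ (c zero) = lincomb-zeroʳ k (tail c) (tail v) j (vⱼ≡0 ∘ suc)

lincomb-congʳ : ∀ {n} k (c : Fin k → Bool) (v v′ : Fin k → Vec₂ n) j →
                (∀ i → v i j ≡ v′ i j) → lincomb k c v j ≡ lincomb k c v′ j
lincomb-congʳ zero    c v v′ j eq = refl
lincomb-congʳ (suc k) c v v′ j eq =
  cong₂ (λ a b → (c zero ∧ a) xor b) (eq zero) (lincomb-congʳ k (tail c) (tail v) (tail v′) j (eq ∘ suc))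

lincomb-insertAt : ∀ {n} k (c : Fin k → Bool) (i : Fin (suc k)) s (v : Fin (suc k) → Vec₂ n) j →
                   lincomb (suc k) (insertAt c i s) v j ≡ (s ∧ v i j) xor lincomb k c (v ∘ punchIn i) j
lincomb-insertAt k       c zero    s v j = refl
lincomb-insertAt (suc k) c (suc i) s v j =
  trans (cong ((c zero ∧ v zero j) xor_) (lincomb-insertAt k (tail c) i s (tail v) j))
        (xor-exchange (c zero ∧ v zero j) (s ∧ v (suc i) j) _)

lincomb-linearˡ : ∀ {n} k (c d : Fin k → Bool) s (w : Fin k → Vec₂ n) j →
                  lincomb k (λ l → c l xor (s ∧ d l)) w j ≡ lincomb k c w j xor (s ∧ lincomb k d w j)
lincomb-linearˡ zero    c d s w j = sym (cong (false xor_) (∧-zeroʳ s))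
lincomb-linearˡ (suc k) c d s w j =
  trans (cong (((c zero xor (s ∧ d zero)) ∧ w zero j) xor_)
              (lincomb-linearˡ k (tail c) (tail d) s (tail w) j))
        (regroup (c zero) s (d zero) (w zero j) _ _)
  where
  regroup : ∀ a s b w x y → ((a xor (s ∧ b)) ∧ w) xor (x xor (s ∧ y))
                          ≡ ((a ∧ w) xor x) xor (s ∧ ((b ∧ w) xor y))
  regroup = solve-∀ 𝔽₂

lincomb-linearʳ : ∀ {n} k (c : Fin k → Bool) (f : Fin k → Vec₂ n) (p : Fin k → Bool) (g : Vec₂ n) j →
                  lincomb k c (λ l t → f l t xor (p l ∧ g t)) j ≡ lincomb k c f j xor (dot k c p ∧ g j)
lincomb-linearʳ zero    c f p g j = refl
lincomb-linearʳ (suc k) c f p g j =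
  trans (cong ((c zero ∧ (f zero j xor (p zero ∧ g j))) xor_)
              (lincomb-linearʳ k (tail c) (tail f) (tail p) g j))
        (regroup (c zero) (f zero j) (p zero) (g j) _ _)
  where
  regroup : ∀ c f p g x d → (c ∧ (f xor (p ∧ g))) xor (x xor (d ∧ g))
                          ≡ ((c ∧ f) xor x) xor (((c ∧ p) xor d) ∧ g)
  regroup = solve-∀ 𝔽₂

LinIndep⇒head≢0 : ∀ {n k} {v : Fin (suc k) → Vec₂ n} → LinIndep (suc k) v → ¬ (∀ j → v zero j ≡ false)
LinIndep⇒head≢0 {k = k} {v} ind v₀≡0 = true≢false (ind (true Vector.∷ λ _ → false) combination≡0 zero)
  where
  combination≡0 : ∀ j → lincomb (suc k) (true Vector.∷ λ _ → false) v j ≡ false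
  combination≡0 j = cong₂ _xor_ (v₀≡0 j) (lincomb-zeroˡ k (λ _ → false) (tail v) j (λ _ → refl))

InSpan-tail : ∀ {n m} {w : Fin (suc m) → Vec₂ n} {v : Vec₂ n} →
              (sp : InSpan (suc m) w v) → proj₁ sp zero ≡ false → InSpan m (tail w) v
InSpan-tail {w = w} (c , eq) c₀≡0 =
  tail c , λ j → trans (cong (λ b → (b ∧ w zero j) xor lincomb _ (tail c) (tail w) j) (sym c₀≡0)) (eq j)

InSpan-xor : ∀ {n m} {w : Fin m → Vec₂ n} {v v′ : Vec₂ n} →
             InSpan m w v → InSpan m w v′ → ∀ s → InSpan m w (λ j → v j xor (s ∧ v′ j))
InSpan-xor {m = m} {w} (c , eq) (c′ , eq′) s =
  (λ l → c l xor (s ∧ c′ l)) ,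
  λ j → trans (lincomb-linearˡ m c c′ s w j) (cong₂ (λ a b → a xor (s ∧ b)) (eq j) (eq′ j))

LinIndep-eliminate : ∀ {n k} {v : Fin (suc k) → Vec₂ n} → LinIndep (suc k) v →
                     ∀ i (p : Fin k → Bool) → LinIndep k (λ l j → v (punchIn i l) j xor (p l ∧ v i j))
LinIndep-eliminate {k = k} {v} ind i p d combination≡0 l =
  trans (sym (insertAt-punchIn d i s l)) (ind (insertAt d i s) extended≡0 (punchIn i l))
  where
  s : Bool
  s = dot k d p
  extended≡0 : ∀ j → lincomb (suc k) (insertAt d i s) v j ≡ false
  extended≡0 j = begin
    lincomb (suc k) (insertAt d i s) v j                       ≡⟨ lincomb-insertAt k d i s v j ⟩
    (s ∧ v i j) xor lincomb k d (v ∘ punchIn i) j               ≡⟨ xor-comm (s ∧ v i j) _ ⟩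
    lincomb k d (v ∘ punchIn i) j xor (s ∧ v i j)               ≡⟨ lincomb-linearʳ k d (v ∘ punchIn i) p (v i) j ⟨
    lincomb k d (λ l t → v (punchIn i l) t xor (p l ∧ v i t)) j ≡⟨ combination≡0 j ⟩
    false                                                       ∎

LinIndep-InSpan⇒≤ : ∀ {n} m (w : Fin m → Vec₂ n) k (v : Fin k → Vec₂ n) →
                    (∀ i → InSpan m w (v i)) → LinIndep k v → k ≤ m
LinIndep-InSpan⇒≤ m       w zero    v span ind = z≤n
LinIndep-InSpan⇒≤ zero    w (suc k) v span ind = ⊥-elim (LinIndep⇒head≢0 {v = v} ind (sym ∘ proj₂ (span zero)))
LinIndep-InSpan⇒≤ (suc m) w (suc k) v span ind with any? (λ i → proj₁ (span i) zero ≟ true)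
... | no noPivot = m≤n⇒m≤1+n (LinIndep-InSpan⇒≤ m (tail w) (suc k) v span′ ind)
  where
  span′ : ∀ i → InSpan m (tail w) (v i)
  span′ i = InSpan-tail {w = w} (span i) (¬-not (λ hit → noPivot (i , hit)))
... | yes (i , pivot) = s≤s (LinIndep-InSpan⇒≤ m (tail w) k _ span′ (LinIndep-eliminate {v = v} ind i p))
  where
  -- Adding p l times the pivot vector v i removes w zero from every other v.
  p : Fin k → Bool
  p l = proj₁ (span (punchIn i l)) zero
  span′ : ∀ l → InSpan m (tail w) (λ j → v (punchIn i l) j xor (p l ∧ v i j))
  span′ l = InSpan-tail {w = w} (InSpan-xor {w = w} (span (punchIn i l)) (span i) (p l)) w₀-eliminated
    where
    w₀-eliminated : p l xor (p l ∧ proj₁ (span i) zero) ≡ false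
    w₀-eliminated rewrite pivot | ∧-identityʳ (p l) = xor-same (p l)

-- The lower bound r₂(G) ≤ 2 b₂(G)

symOuter : ∀ {n} → Vec₂ n → Vec₂ n → Fin n → Fin n → Bool
symOuter x y u v = (x u ∧ y v) xor (y u ∧ x v)

hasEdge≡symOuter : ∀ {n} (B : Biclique n) u v → hasEdge B u v ≡ symOuter (X B) (Y B) u v
hasEdge≡symOuter B u v with X B u | Y B u | disjoint B u
... | false | yu    | _ = ∧-comm (X B v) yu
... | true  | false | _
  rewrite ∧-zeroʳ (X B v) | ∨-identityʳ (Y B v) | xor-identityʳ (Y B v) = refl

sides : ∀ {n} → List (Biclique n) → List (Vec₂ n)
sides []       = []
sides (B ∷ Bs) = X B ∷ Y B ∷ sides Bs

length-sides : ∀ {n} (Bs : List (Biclique n)) → length (sides Bs) ≡ 2 * length Bs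
length-sides []       = refl
length-sides (B ∷ Bs) = trans (cong (2 +_) (length-sides Bs)) (sym (*-suc 2 (length Bs)))

sideCoefficients : ∀ {n} (Bs : List (Biclique n)) → Fin n → Fin (length (sides Bs)) → Bool
sideCoefficients (B ∷ Bs) u zero          = Y B u
sideCoefficients (B ∷ Bs) u (suc zero)    = X B u
sideCoefficients (B ∷ Bs) u (suc (suc i)) = sideCoefficients Bs u i

lincomb-sides : ∀ {n} (Bs : List (Biclique n)) u j →
                lincomb (length (sides Bs)) (sideCoefficients Bs u) (lookup (sides Bs)) j ≡ edgeParity Bs u j
lincomb-sides []       u j = refl
lincomb-sides (B ∷ Bs) u j = begin
  (Y B u ∧ X B j) xor ((X B u ∧ Y B j) xor lincomb _ (sideCoefficients Bs u) (lookup (sides Bs)) j)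
    ≡⟨ cong (λ t → (Y B u ∧ X B j) xor ((X B u ∧ Y B j) xor t)) (lincomb-sides Bs u j) ⟩
  (Y B u ∧ X B j) xor ((X B u ∧ Y B j) xor edgeParity Bs u j)
    ≡⟨ regroup (Y B u ∧ X B j) (X B u ∧ Y B j) (edgeParity Bs u j) ⟩
  symOuter (X B) (Y B) u j xor edgeParity Bs u j
    ≡⟨ cong (_xor edgeParity Bs u j) (hasEdge≡symOuter B u j) ⟨
  edgeParity (B ∷ Bs) u j
    ∎
  where
  regroup : ∀ a b e → a xor (b xor e) ≡ (b xor a) xor e
  regroup = solve-∀ 𝔽₂

edgeParity-diagonal : ∀ {n} (Bs : List (Biclique n)) u → edgeParity Bs u u ≡ false
edgeParity-diagonal []       u = refl
edgeParity-diagonal (B ∷ Bs) u rewrite disjoint B u = edgeParity-diagonal Bs u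

OddCover⇒edgeParity≡adj : ∀ {n} {G : Graph n} {Cs} → OddCover G Cs → ∀ u v → edgeParity Cs u v ≡ adj G u v
OddCover⇒edgeParity≡adj {G = G} {Cs} cover u v with u ≟ᶠ v
... | yes refl = trans (edgeParity-diagonal Cs u) (sym (irrefl G u))
... | no u≢v   = cover u v u≢v

rank≤2*length : ∀ {n} (G : Graph n) {r} → IsRank₂ (adj G) r → ∀ Cs → OddCover G Cs → r ≤ 2 * length Cs
rank≤2*length G {r} ((rows , ind) , _) Cs cover =
  subst (r ≤_) (length-sides Cs) (LinIndep-InSpan⇒≤ _ (lookup (sides Cs)) r _ rowInSpan ind)
  where
  rowInSpan : ∀ i → InSpan _ (lookup (sides Cs)) (adj G (rows i))
  rowInSpan i = sideCoefficients Cs (rows i) ,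
                λ j → trans (lincomb-sides Cs (rows i) j) (OddCover⇒edgeParity≡adj {G = G} {Cs} cover (rows i) j)

-- Elimination along an edge

symOuter-comm : ∀ {n} (x y : Vec₂ n) u v → symOuter x y u v ≡ symOuter x y v u
symOuter-comm x y u v = trans (xor-comm (x u ∧ y v) (y u ∧ x v)) (cong₂ _xor_ (∧-comm (y u) (x v)) (∧-comm (x u) (y v)))

symOuter-swap : ∀ {n} (x y : Vec₂ n) u v → symOuter x y u v ≡ symOuter y x u v
symOuter-swap x y u v = xor-comm (x u ∧ y v) (y u ∧ x v)

symOuter-column : ∀ {n} (x y : Vec₂ n) {w} → x w ≡ true → y w ≡ false → ∀ u → symOuter x y u w ≡ y u
symOuter-column x y {w} xw yw u rewrite xw | yw | ∧-zeroʳ (x u) | ∧-identityʳ (y u) = refl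

symOuter-zero-row : ∀ {n} (x y : Vec₂ n) {u} → x u ≡ false → y u ≡ false → ∀ v → symOuter x y u v ≡ false
symOuter-zero-row x y xu yu v rewrite xu | yu = refl

LinIndep-extend : ∀ {n k} (M M′ : Fin n → Vec₂ n) (x y : Vec₂ n) (a b : Fin n) (R : Fin k → Fin n) →
  (∀ u v → M u v ≡ M′ u v xor symOuter x y u v) → (∀ v → M a v ≡ y v) → (∀ v → M b v ≡ x v) →
  x a ≡ true → y a ≡ false → x b ≡ false → y b ≡ true →
  (∀ u → M′ u a ≡ false) → (∀ u → M′ u b ≡ false) →
  LinIndep k (M′ ∘ R) → LinIndep (suc (suc k)) (M ∘ (a Vector.∷ b Vector.∷ R))
LinIndep-extend {k = k} M M′ x y a b R decomposition Ma Mb xa ya xb yb M′a M′b ind c combination≡0 = c≡0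
  where
  d : Fin k → Bool
  d = tail (tail c)
  P Q α β : Bool
  P = dot k d (x ∘ R)
  Q = dot k d (y ∘ R)
  α = c zero xor P
  β = c (suc zero) xor Q
  L : Vec₂ _
  L = lincomb k d (M′ ∘ R)

  tail-combination : ∀ j → lincomb k d (M ∘ R) j ≡ (L j xor (P ∧ y j)) xor (Q ∧ x j)
  tail-combination j = begin
    lincomb k d (M ∘ R) j
      ≡⟨ lincomb-congʳ k d _ _ j (λ i → trans (decomposition (R i) j) (sym (xor-assoc (M′ (R i) j) _ _))) ⟩
    lincomb k d (λ i t → (M′ (R i) t xor (x (R i) ∧ y t)) xor (y (R i) ∧ x t)) j
      ≡⟨ lincomb-linearʳ k d _ (y ∘ R) x j ⟩
    lincomb k d (λ i t → M′ (R i) t xor (x (R i) ∧ y t)) j xor (Q ∧ x j)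
      ≡⟨ cong (_xor (Q ∧ x j)) (lincomb-linearʳ k d (M′ ∘ R) (x ∘ R) y j) ⟩
    (L j xor (P ∧ y j)) xor (Q ∧ x j)
      ∎

  reduced≡0 : ∀ j → L j xor ((α ∧ y j) xor (β ∧ x j)) ≡ false
  reduced≡0 j = begin
    L j xor ((α ∧ y j) xor (β ∧ x j))
      ≡⟨ regroup (c zero) (c (suc zero)) P Q (L j) (y j) (x j) ⟩
    (c zero ∧ y j) xor ((c (suc zero) ∧ x j) xor ((L j xor (P ∧ y j)) xor (Q ∧ x j)))
      ≡⟨ cong₂ (λ s t → (c zero ∧ s) xor ((c (suc zero) ∧ t) xor ((L j xor (P ∧ y j)) xor (Q ∧ x j)))) (Ma j) (Mb j) ⟨
    (c zero ∧ M a j) xor ((c (suc zero) ∧ M b j) xor ((L j xor (P ∧ y j)) xor (Q ∧ x j)))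
      ≡⟨ cong (λ t → (c zero ∧ M a j) xor ((c (suc zero) ∧ M b j) xor t)) (tail-combination j) ⟨
    lincomb (suc (suc k)) c (M ∘ (a Vector.∷ b Vector.∷ R)) j
      ≡⟨ combination≡0 j ⟩
    false
      ∎
    where
    regroup : ∀ c₀ c₁ P Q l y x → l xor (((c₀ xor P) ∧ y) xor ((c₁ xor Q) ∧ x))
                                ≡ (c₀ ∧ y) xor ((c₁ ∧ x) xor ((l xor (P ∧ y)) xor (Q ∧ x)))
    regroup = solve-∀ 𝔽₂

  -- Coordinate a isolates β and coordinate b isolates α.
  β≡0 : β ≡ false
  β≡0 = trans (sym (at-x α β (lincomb-zeroʳ k d (M′ ∘ R) a (M′a ∘ R)) ya xa)) (reduced≡0 a)
    where
    at-x : ∀ {l s t} α β → l ≡ false → s ≡ false → t ≡ true → l xor ((α ∧ s) xor (β ∧ t)) ≡ β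
    at-x α β refl refl refl = cong₂ _xor_ (∧-zeroʳ α) (∧-identityʳ β)

  α≡0 : α ≡ false
  α≡0 = trans (sym (at-y α β (lincomb-zeroʳ k d (M′ ∘ R) b (M′b ∘ R)) yb xb)) (reduced≡0 b)
    where
    at-y : ∀ {l s t} α β → l ≡ false → s ≡ true → t ≡ false → l xor ((α ∧ s) xor (β ∧ t)) ≡ α
    at-y α β refl refl refl = trans (cong₂ _xor_ (∧-identityʳ α) (∧-zeroʳ β)) (xor-identityʳ α)

  d≡0 : ∀ i → d i ≡ false
  d≡0 = ind d λ j → trans (sym (without-x-y (L j) (y j) (x j) α≡0 β≡0)) (reduced≡0 j)
    where
    without-x-y : ∀ {α β} l s t → α ≡ false → β ≡ false → l xor ((α ∧ s) xor (β ∧ t)) ≡ l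
    without-x-y l s t refl refl = xor-identityʳ l

  c≡0 : ∀ i → c i ≡ false
  c≡0 zero          = trans (xor≡false⇒≡ α≡0) (dot-zeroˡ k d _ d≡0)
  c≡0 (suc zero)    = trans (xor≡false⇒≡ β≡0) (dot-zeroˡ k d _ d≡0)
  c≡0 (suc (suc i)) = d≡0 i

record BipartiteSymmetric {n} (side : Fin n → Bool) (M : Fin n → Vec₂ n) : Set where
  field
    symmetric      : ∀ u v → M u v ≡ M v u
    vanishesInSide : ∀ u v → side u ≡ side v → M u v ≡ false

  crossesSides : ∀ {u v} → M u v ≡ true → side v ≡ not (side u)
  crossesSides {u} {v} Muv = ¬-not (λ same → true≢false (trans (sym Muv) (vanishesInSide u v (sym same))))

RespectsBiclique-intro : ∀ {n} (side : Fin n → Bool) (B : Biclique n) c →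
  (∀ u → X B u ≡ true → side u ≡ c) → (∀ v → Y B v ≡ true → side v ≡ not c) → RespectsBiclique side B
RespectsBiclique-intro side B true  inX inY =
  inj₁ (inX , λ v Yv → cong (λ s → if s then false else true) (inY v Yv))
RespectsBiclique-intro side B false inX inY =
  inj₂ ((λ u Xu → cong (λ s → if s then false else true) (inX u Xu)) , inY)

module Elimination {n} {side : Fin n → Bool} {M : Fin n → Vec₂ n} (bip : BipartiteSymmetric side M)
                   {a b : Fin n} (Mab : M a b ≡ true) where
  open BipartiteSymmetric bip

  x y : Vec₂ n
  x u = M u b
  y   = M a

  x⇒side-a : ∀ {u} → x u ≡ true → side u ≡ side a
  x⇒side-a xu = not-injective (trans (sym (crossesSides xu)) (crossesSides Mab))

  x∧y-inSide : ∀ u v → side u ≡ side v → x u ∧ y v ≡ false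
  x∧y-inSide u v same with x u in xu
  ... | false = refl
  ... | true  = vanishesInSide a v (trans (sym (x⇒side-a xu)) same)

  pivot : Biclique n
  pivot = biclique x y (λ u → x∧y-inSide u u refl)

  pivot-respects : RespectsBiclique side pivot
  pivot-respects = RespectsBiclique-intro side pivot (side a) (λ u → x⇒side-a) (λ v → crossesSides)

  M′ : Fin n → Vec₂ n
  M′ u v = M u v xor symOuter x y u v

  M′-bipartiteSymmetric : BipartiteSymmetric side M′
  M′-bipartiteSymmetric = record
    { symmetric      = λ u v → cong₂ _xor_ (symmetric u v) (symOuter-comm x y u v)
    ; vanishesInSide = M′-vanishesInSide
    }
    where
    M′-vanishesInSide : ∀ u v → side u ≡ side v → M′ u v ≡ false
    M′-vanishesInSide u v same =
      cong₂ _xor_ (vanishesInSide u v same)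
                  (cong₂ _xor_ (x∧y-inSide u v same) (trans (∧-comm (y u) (x v)) (x∧y-inSide v u (sym same))))

  x-a : x a ≡ true
  x-a = Mab

  y-a : y a ≡ false
  y-a = vanishesInSide a a refl

  x-b : x b ≡ false
  x-b = vanishesInSide b b refl

  y-b : y b ≡ true
  y-b = Mab

  M′-column-a : ∀ u → M′ u a ≡ false
  M′-column-a u =
    trans (cong (M u a xor_) (trans (symOuter-column x y x-a y-a u) (symmetric a u))) (xor-same (M u a))

  M′-column-b : ∀ u → M′ u b ≡ false
  M′-column-b u =
    trans (cong (M u b xor_) (trans (symOuter-swap x y u b) (symOuter-column y x y-b x-b u))) (xor-same (M u b))

  M′-row-a : ∀ v → M′ a v ≡ false
  M′-row-a v = trans (cong₂ _xor_ (symmetric a v) (symOuter-comm x y a v)) (M′-column-a v)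

  M′-zero-row : ∀ u → (∀ v → M u v ≡ false) → ∀ v → M′ u v ≡ false
  M′-zero-row u Mu≡0 v =
    trans (cong (M u v xor_) (symOuter-zero-row x y (Mu≡0 b) (trans (symmetric a u) (Mu≡0 a)) v))
          (trans (xor-identityʳ (M u v)) (Mu≡0 v))

  M≡M′⊕symOuter : ∀ u v → M u v ≡ M′ u v xor symOuter x y u v
  M≡M′⊕symOuter u v = sym (xor-cancelʳ (M u v) _)

  M≡pivot⊕M′ : ∀ u v → M u v ≡ hasEdge pivot u v xor M′ u v
  M≡pivot⊕M′ u v =
    trans (sym (xor-cancelˡ (M u v) (symOuter x y u v))) (cong (_xor M′ u v) (sym (hasEdge≡symOuter pivot u v)))

  extend-rows : ∀ {k} (R : Fin k → Fin n) → LinIndep k (M′ ∘ R) →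
                LinIndep (suc (suc k)) (M ∘ (a Vector.∷ b Vector.∷ R))
  extend-rows R = LinIndep-extend M M′ x y a b R M≡M′⊕symOuter (λ _ → refl) (λ v → symmetric b v)
                                  x-a y-a x-b y-b M′-column-a M′-column-b

record Reduction {n} (side : Fin n → Bool) (M : Fin n → Vec₂ n) (vs : List (Fin n)) : Set where
  field
    bicliques      : List (Biclique n)
    respects       : Respects side bicliques
    residual       : Fin n → Vec₂ n
    decomposition  : ∀ u v → M u v ≡ edgeParity bicliques u v xor residual u v
    residualOn-vs  : ∀ u → u ∈ vs → ∀ v → residual u v ≡ false
    -- keeps the row of a vertex zeroed by an earlier elimination step zero through later steps
    residualOnZero : ∀ u → (∀ v → M u v ≡ false) → ∀ v → residual u v ≡ false
    rows           : Fin (length (sides bicliques)) → Fin n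
    rowsIndep      : LinIndep (length (sides bicliques)) (M ∘ rows)

reduce : ∀ {n} {side : Fin n → Bool} {M : Fin n → Vec₂ n} →
         BipartiteSymmetric side M → (vs : List (Fin n)) → Reduction side M vs
reduce {M = M} bip [] = record
  { bicliques = [] ; respects = [] ; residual = M ; decomposition = λ u v → refl
  ; residualOn-vs = λ u () ; residualOnZero = λ u Mu≡0 → Mu≡0
  ; rows = λ () ; rowsIndep = λ c _ () }
reduce {M = M} bip (a ∷ vs) with any? (λ b → M a b ≟ true)
... | no rowZero = record
  { bicliques      = R.bicliques
  ; respects       = R.respects
  ; residual       = R.residual
  ; decomposition  = R.decomposition
  ; residualOn-vs  = λ { u (here refl) → R.residualOnZero a (λ v → ¬-not (λ Mav → rowZero (v , Mav)))
                       ; u (there u∈vs) → R.residualOn-vs u u∈vs }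
  ; residualOnZero = R.residualOnZero
  ; rows           = R.rows
  ; rowsIndep      = R.rowsIndep
  }
  where
  module R = Reduction (reduce bip vs)
... | yes (b , Mab) = record
  { bicliques      = pivot ∷ R.bicliques
  ; respects       = pivot-respects ∷ R.respects
  ; residual       = R.residual
  ; decomposition  = λ u v → begin
      M u v                                                       ≡⟨ M≡pivot⊕M′ u v ⟩
      hasEdge pivot u v xor M′ u v                                ≡⟨ cong (hasEdge pivot u v xor_) (R.decomposition u v) ⟩
      hasEdge pivot u v xor (edgeParity R.bicliques u v xor R.residual u v) ≡⟨ xor-assoc (hasEdge pivot u v) _ _ ⟨
      edgeParity (pivot ∷ R.bicliques) u v xor R.residual u v     ∎
  ; residualOn-vs  = λ { u (here refl) → R.residualOnZero a M′-row-a
                       ; u (there u∈vs) → R.residualOn-vs u u∈vs }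
  ; residualOnZero = λ u Mu≡0 → R.residualOnZero u (M′-zero-row u Mu≡0)
  ; rows           = a Vector.∷ b Vector.∷ R.rows
  ; rowsIndep      = extend-rows R.rows R.rowsIndep
  }
  where
  open Elimination bip Mab
  module R = Reduction (reduce M′-bipartiteSymmetric vs)

adj-bipartiteSymmetric : ∀ {n} (G : Graph n) {side} → IsBipartition G side → BipartiteSymmetric side (adj G)
adj-bipartiteSymmetric G bip = record
  { symmetric      = symm G
  ; vanishesInSide = λ u v same → ¬-not (λ edge → bip u v edge same)
  }

theorem4p4 : ∀ (n : ℕ) (G : Graph n) (side : Fin n → Bool)
    → IsBipartition G side
    → ∀ (r : ℕ) → IsRank₂ (adj G) r
    → Σ (List (Biclique n)) (λ Bs →
        MinimumOddCover G Bs × Respects side Bs × 2 * length Bs ≡ r)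
theorem4p4 n G side bip r rank = bicliques , (cover , minimum) , respects , 2*length≡r
  where
  open Reduction (reduce (adj-bipartiteSymmetric G bip) (allFin n))

  cover : OddCover G bicliques
  cover u v _ = sym (begin
    adj G u v                                      ≡⟨ decomposition u v ⟩
    edgeParity bicliques u v xor residual u v      ≡⟨ cong (edgeParity bicliques u v xor_) (residualOn-vs u (∈-allFin u) v) ⟩
    edgeParity bicliques u v xor false             ≡⟨ xor-identityʳ _ ⟩
    edgeParity bicliques u v                       ∎)

  2*length≡r : 2 * length bicliques ≡ r
  2*length≡r = ≤-antisym (subst (_≤ r) (length-sides bicliques) (proj₂ rank _ rows rowsIndep))
                         (rank≤2*length G rank bicliques cover)

  minimum : ∀ Cs → OddCover G Cs → length bicliques ≤ length Cs
  minimum Cs coverCs = *-cancelˡ-≤ 2 (subst (_≤ 2 * length Cs) (sym 2*length≡r) (rank≤2*length G rank Cs coverCs))
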